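{- Every finite bridgeless triangulated (chordal) undirected graph is $4$-flowing.
   Context: A graph is triangulated (chordal) if every cycle of length at least $4$ has a chord. A bridgeless graph is one with no cut-edge (coloop). An undirected graph is $4$-flowing if some orientation of it admits a nowhere-zero $4$-flow, i.e., a map $\phi:E\to\mathbb{Z}_4\setminus\{0\}$ such that at every vertex $v$, the sum of $\phi$ over arcs with head $v$ minus the sum of $\phi$ over arcs with tail $v$ is $0$ in $\mathbb{Z}_4$. -}

module Defs where

open import Data.Nat using (ℕ; zero; suc; _≤_)
open import Data.Fin using (Fin; zero; suc; toℕ; fromℕ<; _≟_)
open import Data.Fin.Properties using ()
open import Data.Nat.DivMod using (m%n<n)
open import Data.Empty using (⊥)
open import Relation.Nullary using (yes; no)
open import Data.Bool using (Bool; if_then_else_)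
open import Data.Product using (_×_; _,_; proj₁; proj₂; Σ; ∃)
open import Data.Sum using (_⊎_)
open import Data.Integer using (ℤ; +_; _-_; _+_; _*_)
open import Data.Integer.Divisibility using () renaming (_∣_ to _∣ℤ_)
open import Relation.Binary.PropositionalEquality using (_≡_; _≢_)
open import Function.Definitions using (Injective)

-- A finite undirected multigraph (loops and parallel edges allowed):
-- vertices Fin n, edges Fin m, each edge has an (unordered) pair of ends,
-- stored as an ordered pair whose order carries no meaning.
record Graph : Set where
  field
    n    : ℕ
    m    : ℕ
    ends : Fin m → Fin n × Fin n
open Graph public

Adj : (G : Graph) → Fin (n G) → Fin (n G) → Set
Adj G u v = ∃ λ e → (ends G e ≡ (u , v)) ⊎ (ends G e ≡ (v , u))

csuc : {k : ℕ} → Fin k → Fin k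
csuc {suc k} i = fromℕ< (m%n<n (suc (toℕ i)) (suc k))

IsCycle : (G : Graph) (k : ℕ) → (Fin k → Fin (n G)) → Set
IsCycle G k c = Injective _≡_ _≡_ c × (∀ i → Adj G (c i) (c (csuc i)))

Chordal : Graph → Set
Chordal G = ∀ (k : ℕ) → 4 ≤ k → (c : Fin k → Fin (n G)) → IsCycle G k c →
  ∃ λ i → ∃ λ j → i ≢ j × j ≢ csuc i × i ≢ csuc j × Adj G (c i) (c j)

data ReachWithout (G : Graph) (e : Fin (m G)) : Fin (n G) → Fin (n G) → Set where
  here : ∀ {u} → ReachWithout G e u u
  step : ∀ {u v w} (f : Fin (m G)) → f ≢ e →
         ((ends G f ≡ (u , v)) ⊎ (ends G f ≡ (v , u))) →
         ReachWithout G e v w → ReachWithout G e u w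

IsBridge : (G : Graph) → Fin (m G) → Set
IsBridge G e = ReachWithout G e (proj₁ (ends G e)) (proj₂ (ends G e)) → ⊥

Bridgeless : Graph → Set
Bridgeless G = ∀ e → IsBridge G e → ⊥

sumFin : (m : ℕ) → (Fin m → ℤ) → ℤ
sumFin zero    f = + 0
sumFin (suc m) f = f zero + sumFin m (λ i → f (suc i))

Orientation : Graph → Set
Orientation G = Fin (m G) → Bool

tail head : (G : Graph) → Orientation G → Fin (m G) → Fin (n G)
tail G o e = if o e then proj₁ (ends G e) else proj₂ (ends G e)
head G o e = if o e then proj₂ (ends G e) else proj₁ (ends G e)

[_≟v_] : {n : ℕ} → Fin n → Fin n → ℤ
[ a ≟v b ] with a ≟ b
... | yes _ = + 1
... | no _  = + 0

-- Z4 is represented by Fin 4; values are lifted to ℤ and the conservation law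
-- is imposed modulo 4.
-- Nowhere-zero 4-flow on G with orientation o:
-- φ e ≠ 0 and, at every vertex v, (Σ_{head e = v} φ e) − (Σ_{tail e = v} φ e) ≡ 0 (mod 4).
NZ4Flow : (G : Graph) → Orientation G → (Fin (m G) → Fin 4) → Set
NZ4Flow G o φ =
  (∀ e → φ e ≢ zero) ×
  (∀ v → (+ 4) ∣ℤ (sumFin (m G) (λ e → [ head G o e ≟v v ] * (+ toℕ (φ e)))
                  - sumFin (m G) (λ e → [ tail G o e ≟v v ] * (+ toℕ (φ e)))))

FourFlowing : Graph → Set
FourFlowing G = Σ (Orientation G) λ o → Σ (Fin (m G) → Fin 4) λ φ → NZ4Flow G o φ

-- In a chordal graph every edge e = xz that is not a bridge lies on a loop, a digon or a
-- triangle: a shortest x–z walk avoiding e is a path, and if it had three or more edges then,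
-- closed up by e, it would be a cycle of length at least 4 whose chord yields a shorter walk.
-- Such a short cycle through e carries an integer circulation that is 1 on e, ±1 on at most two
-- further edges and 0 elsewhere.  Starting from the zero circulation, treat the edges in turn:
-- if the current circulation f is divisible by 4 on e, add a times the short cycle of e, where
-- a ∈ {1, 2, 3} is chosen so that neither of the other two edges becomes divisible by 4; each
-- of them rules out at most one value of a.  Reducing the final f modulo 4 gives a nowhere-zero
-- ℤ₄-flow.

module Submission where

open import Defs

open import Data.Bool using (true)
open import Data.Empty using (⊥; ⊥-elim)
open import Data.Fin using (Fin; zero; suc; toℕ; fromℕ; fromℕ<; inject₁; _≟_)
open import Data.Fin.Properties
  using (all?; any?; toℕ-fromℕ<; toℕ-fromℕ; toℕ-inject₁; toℕ-injective; toℕ<n)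
open import Data.Fin.Relation.Unary.Top using (view; ‵fromℕ; ‵inject₁)
open import Data.Integer using (ℤ; +_; _+_; _*_; _-_; -_; 0ℤ; 1ℤ; -1ℤ; _/ℕ_)
open import Data.Integer.DivMod using (a≡a%ℕn+[a/ℕn]*n; n%ℕd<d)
open import Data.Integer.Divisibility.Signed
  using (_∣_; divides; _∣?_; ∣-refl; ∣⇒∣ᵤ; ∣m∣n⇒∣m+n; ∣m+n∣m⇒∣n; ∣m+n∣n⇒∣m; ∣m⇒∣m*n)
open import Data.Integer.Properties
  using (+-*-semiring; *-zeroʳ; *-identityˡ; *-identityʳ; +-inverseʳ; +-identityˡ; +-identityʳ; *-comm)
open import Data.Integer.Tactic.RingSolver using (solve-∀)
open import Data.List using (List; []; _∷_; allFin)
open import Data.List.Membership.Propositional using (_∈_)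
open import Data.List.Membership.Propositional.Properties using (∈-allFin)
open import Data.List.Relation.Unary.All as All using (All; []; _∷_)
open import Data.List.Relation.Unary.Any as Any using ()
open import Data.Nat as ℕ using (ℕ; zero; suc; _≤_; _<_; z≤n; s≤s)
open import Data.Nat.DivMod using (n%n≡0; m<n⇒m%n≡m)
open import Data.Nat.Induction using (<-rec)
open import Data.Nat.Properties
  using (≤-trans; ≤-reflexive; ≤-pred; n≤1+n; m≤n+m; <-cmp; <-≤-trans; ≤∧≢⇒<; <⇒≱; +-suc; +-monoˡ-<;
         module ≤-Reasoning)
open import Data.Product using (Σ; ∃; _×_; _,_; proj₁; proj₂)
open import Data.Product.Properties using (≡-dec; ,-injectiveˡ; ,-injectiveʳ)
open import Data.Sum using (_⊎_; inj₁; inj₂)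
open import Data.Unit using (⊤; tt)
open import Function.Definitions using (Injective)
open import Relation.Binary.Definitions using (tri<; tri≈; tri>)
open import Relation.Binary.PropositionalEquality
  using (_≡_; _≢_; _≗_; ≢-sym; refl; sym; trans; cong; cong₂; subst; module ≡-Reasoning)
open import Relation.Nullary using (Dec; yes; no; ¬_; ¬?; _×-dec_; _⊎-dec_; _→-dec_)
open import Relation.Nullary.Decidable using (from-yes; map′)

open import Algebra.Properties.Semiring.Sum +-*-semiring
  using (sum; sum-cong-≗; ∑-distrib-+; *-distribˡ-sum; sum-replicate-zero)

sumFin≡sum : ∀ k (f : Fin k → ℤ) → sumFin k f ≡ sum f
sumFin≡sum zero    f = refl
sumFin≡sum (suc k) f = cong (_+_ (f zero)) (sumFin≡sum k (λ i → f (suc i)))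

sum-linear : ∀ {k} (f g : Fin k → ℤ) a → sum (λ i → f i + a * g i) ≡ sum f + a * sum g
sum-linear f g a =
  trans (∑-distrib-+ f (λ i → a * g i)) (cong (_+_ (sum f)) (sym (*-distribˡ-sum a g)))

δ : ∀ {k} → Fin k → Fin k → ℤ
δ zero    zero    = 1ℤ
δ zero    (suc _) = 0ℤ
δ (suc _) zero    = 0ℤ
δ (suc i) (suc j) = δ i j

δ-refl : ∀ {k} (i : Fin k) → δ i i ≡ 1ℤ
δ-refl zero    = refl
δ-refl (suc i) = δ-refl i

δ-≢ : ∀ {k} {i j : Fin k} → i ≢ j → δ i j ≡ 0ℤ
δ-≢ {i = zero}  {zero}  i≢j = ⊥-elim (i≢j refl)
δ-≢ {i = zero}  {suc j} _   = refl
δ-≢ {i = suc i} {zero}  _   = refl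
δ-≢ {i = suc i} {suc j} i≢j = δ-≢ (λ i≡j → i≢j (cong suc i≡j))

sum-δ : ∀ {k} (c : Fin k → ℤ) (i : Fin k) → sum (λ j → c j * δ i j) ≡ c i
sum-δ {suc k} c zero = trans (cong₂ _+_ (*-identityʳ (c zero)) sum-zeros) (+-identityʳ (c zero))
  where
  sum-zeros : sum (λ j → c (suc j) * 0ℤ) ≡ 0ℤ
  sum-zeros = trans (sum-cong-≗ (λ j → *-zeroʳ (c (suc j)))) (sum-replicate-zero k)
sum-δ c (suc i) =
  trans (cong₂ _+_ (*-zeroʳ (c zero)) (sum-δ (λ j → c (suc j)) i)) (+-identityˡ (c (suc i)))

module Walks (G : Graph) (e : Fin (m G)) where

  Joins : Fin (m G) → Fin (n G) → Fin (n G) → Set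
  Joins d x y = (ends G d ≡ (x , y)) ⊎ (ends G d ≡ (y , x))

  Joins-sym : ∀ {d x y} → Joins d x y → Joins d y x
  Joins-sym (inj₁ eq) = inj₂ eq
  Joins-sym (inj₂ eq) = inj₁ eq

  Walk : Fin (n G) → Fin (n G) → Set
  Walk = ReachWithout G e

  length : ∀ {x z} → Walk x z → ℕ
  length here           = 0
  length (step _ _ _ w) = suc (length w)

  vertex : ∀ {x z} (w : Walk x z) → Fin (suc (length w)) → Fin (n G)
  vertex {x} w              zero    = x
  vertex     (step _ _ _ w) (suc i) = vertex w i

  vertex-last : ∀ {x z} (w : Walk x z) → vertex w (fromℕ (length w)) ≡ z
  vertex-last here           = refl
  vertex-last (step _ _ _ w) = vertex-last w

  edge-at : ∀ {x z} (w : Walk x z) (i : Fin (length w)) →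
            ∃ λ d → d ≢ e × Joins d (vertex w (inject₁ i)) (vertex w (suc i))
  edge-at (step d d≢e j w) zero    = d , d≢e , j
  edge-at (step _ _   _ w) (suc i) = edge-at w i

  take : ∀ {x z} (w : Walk x z) (i : Fin (suc (length w))) → Walk x (vertex w i)
  take w                  zero    = here
  take (step d d≢e j w)   (suc i) = step d d≢e j (take w i)

  length-take : ∀ {x z} (w : Walk x z) i → length (take w i) ≡ toℕ i
  length-take w              zero    = refl
  length-take (step _ _ _ w) (suc i) = cong suc (length-take w i)

  drop : ∀ {x z} (w : Walk x z) (i : Fin (suc (length w))) → Walk (vertex w i) z
  drop w              zero    = w
  drop (step _ _ _ w) (suc i) = drop w i

  length-drop : ∀ {x z} (w : Walk x z) i → toℕ i ℕ.+ length (drop w i) ≡ length w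
  length-drop w              zero    = refl
  length-drop (step _ _ _ w) (suc i) = cong suc (length-drop w i)

  _++_ : ∀ {x y z} → Walk x y → Walk y z → Walk x z
  here             ++ w′ = w′
  step d d≢e j w   ++ w′ = step d d≢e j (w ++ w′)

  length-++ : ∀ {x y z} (w : Walk x y) (w′ : Walk y z) → length (w ++ w′) ≡ length w ℕ.+ length w′
  length-++ here           w′ = refl
  length-++ (step _ _ _ w) w′ = cong suc (length-++ w w′)

  Simple : ∀ {x z} → Walk x z → Set
  Simple here                 = ⊤
  Simple (step {u} _ _ _ w)   = (∀ i → vertex w i ≢ u) × Simple w

  vertex-injective : ∀ {x z} (w : Walk x z) → Simple w → Injective _≡_ _≡_ (vertex w)
  vertex-injective w              _            {zero}  {zero}  _  = refl
  vertex-injective (step _ _ _ w) (x∉w , _)    {zero}  {suc j} eq = ⊥-elim (x∉w j (sym eq))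
  vertex-injective (step _ _ _ w) (x∉w , _)    {suc i} {zero}  eq = ⊥-elim (x∉w i eq)
  vertex-injective (step _ _ _ w) (_ , simple) {suc i} {suc j} eq = cong suc (vertex-injective w simple eq)

  drop-simple : ∀ {x z} (w : Walk x z) i → Simple w → Simple (drop w i)
  drop-simple w              zero    simple       = simple
  drop-simple (step _ _ _ w) (suc i) (_ , simple) = drop-simple w i simple

  path-edges-distinct : ∀ {d₁ d₂ x y z} → y ≢ x → z ≢ x → z ≢ y → Joins d₁ x y → Joins d₂ y z → d₁ ≢ d₂
  path-edges-distinct y≢x _   _   (inj₁ p) (inj₁ q) refl = y≢x (sym (,-injectiveˡ (trans (sym p) q)))
  path-edges-distinct _   z≢x _   (inj₁ p) (inj₂ q) refl = z≢x (sym (,-injectiveˡ (trans (sym p) q)))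
  path-edges-distinct _   z≢x _   (inj₂ p) (inj₁ q) refl = z≢x (sym (,-injectiveʳ (trans (sym p) q)))
  path-edges-distinct _   _   z≢y (inj₂ p) (inj₂ q) refl = z≢y (sym (,-injectiveˡ (trans (sym p) q)))

  data ShortDetour (x z : Fin (n G)) : Set where
    loop     : x ≡ z → ShortDetour x z
    parallel : ∀ d → d ≢ e → Joins d x z → ShortDetour x z
    triangle : ∀ y d₁ d₂ → d₁ ≢ e → d₂ ≢ e → d₁ ≢ d₂ → Joins d₁ x y → Joins d₂ y z → ShortDetour x z

  Joins? : ∀ d x y → Dec (Joins d x y)
  Joins? d x y = ≡-dec _≟_ _≟_ (ends G d) (x , y) ⊎-dec ≡-dec _≟_ _≟_ (ends G d) (y , x)

  ShortDetour? : ∀ x z → Dec (ShortDetour x z)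
  ShortDetour? x z = map′
    (λ { (inj₁ x≡z)                         → loop x≡z
       ; (inj₂ (inj₁ (d , d≢e , j)))         → parallel d d≢e j
       ; (inj₂ (inj₂ (y , d₁ , d₂ , rest))) → let d₁≢e , d₂≢e , d₁≢d₂ , j₁ , j₂ = rest in
                                               triangle y d₁ d₂ d₁≢e d₂≢e d₁≢d₂ j₁ j₂ })
    (λ { (loop x≡z)                                → inj₁ x≡z
       ; (parallel d d≢e j)                        → inj₂ (inj₁ (d , d≢e , j))
       ; (triangle y d₁ d₂ d₁≢e d₂≢e d₁≢d₂ j₁ j₂) → inj₂ (inj₂ (y , d₁ , d₂ , d₁≢e , d₂≢e , d₁≢d₂ , j₁ , j₂)) })
    ((x ≟ z) ⊎-dec (any? λ d → ¬? (d ≟ e) ×-dec Joins? d x z) ⊎-dec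
     (any? λ y → any? λ d₁ → any? λ d₂ → ¬? (d₁ ≟ e) ×-dec ¬? (d₂ ≟ e) ×-dec ¬? (d₁ ≟ d₂) ×-dec
                                         Joins? d₁ x y ×-dec Joins? d₂ y z))

  length-drop-≤ : ∀ {x z} (w : Walk x z) i → length (drop w i) ≤ length w
  length-drop-≤ w i = ≤-trans (m≤n+m _ (toℕ i)) (≤-reflexive (length-drop w i))

  simplify : ∀ {x z} (w : Walk x z) → Σ (Walk x z) λ w′ → Simple w′ × length w′ ≤ length w
  simplify here = here , tt , z≤n
  simplify (step {x} d d≢e j w) with simplify w
  ... | w′ , simple , w′≤w with any? (λ i → vertex w′ i ≟ x)
  ...   | yes (i , refl) =
    drop w′ i , drop-simple w′ i simple , ≤-trans (length-drop-≤ w′ i) (≤-trans w′≤w (n≤1+n _))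
  ...   | no x∉w′ =
    step d d≢e j w′ , ((λ i eq → x∉w′ (i , eq)) , simple) , s≤s w′≤w

csuc-fromℕ : ∀ k → csuc (fromℕ k) ≡ zero
csuc-fromℕ k = toℕ-injective (begin
  toℕ (csuc (fromℕ k))          ≡⟨ toℕ-fromℕ< _ ⟩
  suc (toℕ (fromℕ k)) ℕ.% suc k ≡⟨ cong (λ t → suc t ℕ.% suc k) (toℕ-fromℕ k) ⟩
  suc k ℕ.% suc k               ≡⟨ n%n≡0 (suc k) ⟩
  0                             ∎)
  where open ≡-Reasoning

toℕ-csuc : ∀ {k} (i : Fin (suc k)) → toℕ i < k → toℕ (csuc i) ≡ suc (toℕ i)
toℕ-csuc i i<k = trans (toℕ-fromℕ< _) (m<n⇒m%n≡m (s≤s i<k))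

csuc-inject₁ : ∀ {k} (i : Fin k) → csuc (inject₁ i) ≡ suc i
csuc-inject₁ {k} i = toℕ-injective (trans (toℕ-csuc (inject₁ i) i<k) (cong suc (toℕ-inject₁ i)))
  where
  i<k : toℕ (inject₁ i) < k
  i<k = subst (_< k) (sym (toℕ-inject₁ i)) (toℕ<n i)

module Shortcut (G : Graph) (e : Fin (m G)) (chordal : Chordal G)
                {x z : Fin (n G)} (ends-e : ends G e ≡ (x , z)) where
  open Walks G e

  closed-walk-isCycle : (w : Walk x z) → Simple w → IsCycle G (suc (length w)) (vertex w)
  closed-walk-isCycle w simple = vertex-injective w simple , adjacent
    where
    adjacent : ∀ i → Adj G (vertex w i) (vertex w (csuc i))
    adjacent i with view i
    ... | ‵fromℕ rewrite csuc-fromℕ (length w) | vertex-last w = e , inj₂ ends-e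
    ... | ‵inject₁ j rewrite csuc-inject₁ j = proj₁ (edge-at w j) , proj₂ (proj₂ (edge-at w j))

  chord-shortcut : (w : Walk x z) → Simple w → (i j : Fin (suc (length w))) → toℕ i < toℕ j →
                   j ≢ csuc i → i ≢ csuc j → ∀ {d} → Joins d (vertex w i) (vertex w j) →
                   Σ (Walk x z) λ w′ → length w′ < length w
  chord-shortcut w simple i j i<j j≢i⁺ i≢j⁺ {d} joins =
    take w i ++ step d d≢e joins (drop w j) , shorter
    where
    inj : Injective _≡_ _≡_ (vertex w)
    inj = vertex-injective w simple

    i⁺<j : suc (toℕ i) < toℕ j
    i⁺<j = ≤∧≢⇒< i<j λ i⁺≡j → j≢i⁺ (toℕ-injective (trans (sym i⁺≡j) (sym (toℕ-csuc i i<last))))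
      where
      i<last : toℕ i < length w
      i<last = <-≤-trans i<j (≤-pred (toℕ<n j))

    d≢e : d ≢ e
    d≢e refl = not-e joins
      where
      not-e : Joins e (vertex w i) (vertex w j) → ⊥
      not-e (inj₁ ends≡ij) = i≢j⁺ (begin
        i                        ≡⟨ inj (,-injectiveˡ ij≡xz) ⟩
        zero                     ≡⟨ csuc-fromℕ (length w) ⟨
        csuc (fromℕ (length w))  ≡⟨ cong csuc (inj (trans (,-injectiveʳ ij≡xz) (sym (vertex-last w)))) ⟨
        csuc j                   ∎)
        where
        open ≡-Reasoning
        ij≡xz : (vertex w i , vertex w j) ≡ (x , z)
        ij≡xz = trans (sym ends≡ij) ends-e
      not-e (inj₂ ends≡ji) = <⇒≱ i<j (subst (λ k → toℕ k ≤ toℕ i) (sym j≡zero) z≤n)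
        where
        j≡zero : j ≡ zero
        j≡zero = inj (,-injectiveˡ (trans (sym ends≡ji) ends-e))

    shorter : length (take w i ++ step d d≢e joins (drop w j)) < length w
    shorter = begin-strict
      length (take w i ++ step d d≢e joins (drop w j)) ≡⟨ length-++ (take w i) _ ⟩
      length (take w i) ℕ.+ suc (length (drop w j))    ≡⟨ cong (ℕ._+ suc (length (drop w j))) (length-take w i) ⟩
      toℕ i ℕ.+ suc (length (drop w j))                ≡⟨ +-suc (toℕ i) _ ⟩
      suc (toℕ i) ℕ.+ length (drop w j)                <⟨ +-monoˡ-< (length (drop w j)) i⁺<j ⟩
      toℕ j ℕ.+ length (drop w j)                      ≡⟨ length-drop w j ⟩
      length w                                         ∎
      where open ≤-Reasoning

  shortcut : (w : Walk x z) → Simple w → 3 ≤ length w → Σ (Walk x z) λ w′ → length w′ < length w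
  shortcut w simple 3≤w with chordal (suc (length w)) (s≤s 3≤w) (vertex w) (closed-walk-isCycle w simple)
  ... | i , j , i≢j , j≢i⁺ , i≢j⁺ , _ , joins with <-cmp (toℕ i) (toℕ j)
  ...   | tri< i<j _ _ = chord-shortcut w simple i j i<j j≢i⁺ i≢j⁺ joins
  ...   | tri≈ _ i≡j _ = ⊥-elim (i≢j (toℕ-injective i≡j))
  ...   | tri> _ _ j<i = chord-shortcut w simple j i j<i i≢j⁺ j≢i⁺ (Joins-sym joins)

  simple-walk⇒short-detour : (w : Walk x z) → Simple w →
                             (∀ (w′ : Walk x z) → length w′ < length w → ShortDetour x z) → ShortDetour x z
  simple-walk⇒short-detour here                _ _ = loop refl
  simple-walk⇒short-detour (step d d≢e j here) _ _ = parallel d d≢e j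
  simple-walk⇒short-detour (step d₁ d₁≢e j₁ (step d₂ d₂≢e j₂ here)) (x∉ , y∉ , _) _ =
    triangle _ d₁ d₂ d₁≢e d₂≢e (path-edges-distinct (x∉ zero) (x∉ (suc zero)) (y∉ zero) j₁ j₂) j₁ j₂
  simple-walk⇒short-detour w@(step _ _ _ (step _ _ _ (step _ _ _ _))) simple recurse =
    let w′ , w′<w = shortcut w simple (s≤s (s≤s (s≤s z≤n))) in recurse w′ w′<w

  walk⇒short-detour : Walk x z → ShortDetour x z
  walk⇒short-detour w =
    <-rec (λ k → (w : Walk x z) → length w ≡ k → ShortDetour x z) detour (length w) w refl
    where
    detour : ∀ k → (∀ {k′} → k′ < k → (w : Walk x z) → length w ≡ k′ → ShortDetour x z) →
             (w : Walk x z) → length w ≡ k → ShortDetour x z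
    detour _ recurse w refl with simplify w
    ... | w′ , simple , w′≤w =
      simple-walk⇒short-detour w′ simple (λ w″ w″<w′ → recurse (<-≤-trans w″<w′ w′≤w) w″ refl)

residue : ℤ → Fin 4
residue x = fromℕ< (n%ℕd<d x 4)

residue-quotient : ∀ x → x ≡ + toℕ (residue x) + + 4 * (x /ℕ 4)
residue-quotient x rewrite toℕ-fromℕ< (n%ℕd<d x 4) | *-comm (+ 4) (x /ℕ 4) = a≡a%ℕn+[a/ℕn]*n x 4

4∣residue⇒4∣ : ∀ x → + 4 ∣ + toℕ (residue x) → + 4 ∣ x
4∣residue⇒4∣ x 4∣r = subst (+ 4 ∣_) (sym (residue-quotient x)) (∣m∣n⇒∣m+n 4∣r (∣m⇒∣m*n (x /ℕ 4) ∣-refl))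

4∣+⇒4∣residue+ : ∀ x c → + 4 ∣ x + c → + 4 ∣ + toℕ (residue x) + c
4∣+⇒4∣residue+ x c 4∣x+c = ∣m+n∣n⇒∣m (subst (+ 4 ∣_) regroup 4∣x+c) (∣m⇒∣m*n (x /ℕ 4) ∣-refl)
  where
  shift : ∀ r q c → r + + 4 * q + c ≡ r + c + + 4 * q
  shift = solve-∀
  regroup : x + c ≡ + toℕ (residue x) + c + + 4 * (x /ℕ 4)
  regroup = trans (cong (_+ c) (residue-quotient x)) (shift (+ toℕ (residue x)) (x /ℕ 4) c)

smallValues : List ℤ
smallValues = 0ℤ ∷ 1ℤ ∷ -1ℤ ∷ []

Small : ℤ → Set
Small u = u ∈ smallValues

SafeMultiplier : ℤ → ℤ → ℤ → ℤ → ℤ → Set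
SafeMultiplier x u y v a = ¬ + 4 ∣ a × (¬ + 4 ∣ x → ¬ + 4 ∣ x + a * u) × (¬ + 4 ∣ y → ¬ + 4 ∣ y + a * v)

SafeMultiplier-residue : ∀ x u y v a →
  SafeMultiplier (+ toℕ (residue x)) u (+ toℕ (residue y)) v a → SafeMultiplier x u y v a
SafeMultiplier-residue x u y v a (4∤a , safe-x , safe-y) =
  4∤a ,
  (λ 4∤x 4∣ → safe-x (λ 4∣r → 4∤x (4∣residue⇒4∣ x 4∣r)) (4∣+⇒4∣residue+ x (a * u) 4∣)) ,
  (λ 4∤y 4∣ → safe-y (λ 4∣r → 4∤y (4∣residue⇒4∣ y 4∣r)) (4∣+⇒4∣residue+ y (a * v) 4∣))

SafeForResidues : ℤ → ℤ → Set
SafeForResidues u v = ∀ (r s : Fin 4) → ∃ λ (a : Fin 4) → SafeMultiplier (+ toℕ r) u (+ toℕ s) v (+ toℕ a)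

safeForResidues? : ∀ u v → Dec (SafeForResidues u v)
safeForResidues? u v = all? λ r → all? λ s → any? λ a →
  ¬? (+ 4 ∣? + toℕ a) ×-dec (¬? (+ 4 ∣? + toℕ r) →-dec ¬? (+ 4 ∣? + toℕ r + + toℕ a * u))
                      ×-dec (¬? (+ 4 ∣? + toℕ s) →-dec ¬? (+ 4 ∣? + toℕ s + + toℕ a * v))

small-safeForResidues : All (λ u → All (SafeForResidues u) smallValues) smallValues
small-safeForResidues = from-yes (All.all? (λ u → All.all? (safeForResidues? u) smallValues) smallValues)

safeMultiplier : ∀ x y {u v} → Small u → Small v → Σ ℤ (SafeMultiplier x u y v)
safeMultiplier x y {u} {v} u-small v-small =
  let a , safe = All.lookup (All.lookup small-safeForResidues u-small) v-small (residue x) (residue y)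
  in + toℕ a , SafeMultiplier-residue x u y v (+ toℕ a) safe

module Flows (G : Graph) where

  byEnds : Orientation G
  byEnds _ = true

  incidence : Fin (m G) → Fin (n G) → ℤ
  incidence d v = [ head G byEnds d ≟v v ] - [ tail G byEnds d ≟v v ]

  ∂ : (Fin (m G) → ℤ) → Fin (n G) → ℤ
  ∂ f v = sum (λ d → incidence d v * f d)

  IsCirculation : (Fin (m G) → ℤ) → Set
  IsCirculation f = ∀ v → ∂ f v ≡ 0ℤ

  ∂-cong : ∀ {f g} → f ≗ g → ∀ v → ∂ f v ≡ ∂ g v
  ∂-cong f≗g v = sum-cong-≗ (λ d → cong (incidence d v *_) (f≗g d))

  ∂-linear : ∀ f a g v → ∂ (λ d → f d + a * g d) v ≡ ∂ f v + a * ∂ g v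
  ∂-linear f a g v = trans (sum-cong-≗ (λ d → distrib (incidence d v) (f d) a (g d)))
                           (sum-linear (λ d → incidence d v * f d) (λ d → incidence d v * g d) a)
    where
    distrib : ∀ c x a y → c * (x + a * y) ≡ c * x + a * (c * y)
    distrib = solve-∀

  ∂-δ : ∀ d v → ∂ (δ d) v ≡ incidence d v
  ∂-δ d v = sum-δ (λ d' → incidence d' v) d

  ∂-sumFin : ∀ f v → sumFin (m G) (λ d → [ head G byEnds d ≟v v ] * f d)
                    - sumFin (m G) (λ d → [ tail G byEnds d ≟v v ] * f d) ≡ ∂ f v
  ∂-sumFin f v = begin
    sumFin (m G) h - sumFin (m G) t ≡⟨ cong₂ _-_ (sumFin≡sum (m G) h) (sumFin≡sum (m G) t) ⟩
    sum h - sum t                   ≡⟨ minus (sum h) (sum t) ⟩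
    sum h + -1ℤ * sum t             ≡⟨ sum-linear h t -1ℤ ⟨
    sum (λ d → h d + -1ℤ * t d)     ≡⟨ sum-cong-≗ (λ d → distrib [ head G byEnds d ≟v v ]
                                                                  [ tail G byEnds d ≟v v ] (f d)) ⟩
    ∂ f v                           ∎
    where
    open ≡-Reasoning
    h t : Fin (m G) → ℤ
    h d = [ head G byEnds d ≟v v ] * f d
    t d = [ tail G byEnds d ≟v v ] * f d
    minus : ∀ x y → x - y ≡ x + -1ℤ * y
    minus = solve-∀
    distrib : ∀ a b x → a * x + -1ℤ * (b * x) ≡ (a - b) * x
    distrib = solve-∀

  ∂-zero : IsCirculation (λ _ → 0ℤ)
  ∂-zero v = trans (sum-cong-≗ (λ d → *-zeroʳ (incidence d v))) (sum-replicate-zero (m G))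

  record ShortCircuit (e : Fin (m G)) : Set where
    field
      flow          : Fin (m G) → ℤ
      isCirculation : IsCirculation flow
      flow-e        : flow e ≡ 1ℤ
      d₁ d₂         : Fin (m G)
      small₁        : Small (flow d₁)
      small₂        : Small (flow d₂)
      vanishes      : ∀ d → d ≢ e → d ≢ d₁ → d ≢ d₂ → flow d ≡ 0ℤ

  Repairs : (Fin (m G) → ℤ) → Fin (m G) → (Fin (m G) → ℤ) → Set
  Repairs f e f′ = IsCirculation f′ × ¬ + 4 ∣ f′ e × (∀ d → ¬ + 4 ∣ f d → ¬ + 4 ∣ f′ d)

  repair : ∀ {f} → IsCirculation f → ∀ e → ShortCircuit e → Σ (Fin (m G) → ℤ) (Repairs f e)
  repair {f} f-circ e circuit with + 4 ∣? f e
  ... | no 4∤fe  = f , f-circ , 4∤fe , λ _ 4∤fd → 4∤fd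
  ... | yes 4∣fe = add (safeMultiplier (f d₁) (f d₂) small₁ small₂)
    where
    open ShortCircuit circuit

    add : Σ ℤ (SafeMultiplier (f d₁) (flow d₁) (f d₂) (flow d₂)) → Σ (Fin (m G) → ℤ) (Repairs f e)
    add (a , 4∤a , safe₁ , safe₂) = (λ d → f d + a * flow d) , f′-circ , 4∤f′e , preserved
      where
      f′-circ : IsCirculation (λ d → f d + a * flow d)
      f′-circ v = begin
        ∂ (λ d → f d + a * flow d) v ≡⟨ ∂-linear f a flow v ⟩
        ∂ f v + a * ∂ flow v         ≡⟨ cong₂ (λ p q → p + a * q) (f-circ v) (isCirculation v) ⟩
        0ℤ + a * 0ℤ                  ≡⟨ cong (_+_ 0ℤ) (*-zeroʳ a) ⟩
        0ℤ                           ∎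
        where open ≡-Reasoning

      4∤f′e : ¬ + 4 ∣ f e + a * flow e
      4∤f′e 4∣f′e rewrite flow-e | *-identityʳ a = 4∤a (∣m+n∣m⇒∣n 4∣f′e 4∣fe)

      preserved : ∀ d → ¬ + 4 ∣ f d → ¬ + 4 ∣ f d + a * flow d
      preserved d 4∤fd with d ≟ e | d ≟ d₁ | d ≟ d₂
      ... | yes refl | _        | _        = ⊥-elim (4∤fd 4∣fe)
      ... | no _     | yes refl | _        = safe₁ 4∤fd
      ... | no _     | no _     | yes refl = safe₂ 4∤fd
      ... | no d≢e   | no d≢d₁  | no d≢d₂
        rewrite vanishes d d≢e d≢d₁ d≢d₂ | *-zeroʳ a | +-identityʳ (f d) = 4∤fd

  nowhere-zero-on : (∀ e → ShortCircuit e) → (ds : List (Fin (m G))) →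
                    Σ (Fin (m G) → ℤ) λ f → IsCirculation f × All (λ d → ¬ + 4 ∣ f d) ds
  nowhere-zero-on circuits []       = (λ _ → 0ℤ) , ∂-zero , []
  nowhere-zero-on circuits (e ∷ ds) with nowhere-zero-on circuits ds
  ... | f , f-circ , nz with repair f-circ e (circuits e)
  ...   | f′ , f′-circ , 4∤f′e , preserved = f′ , f′-circ , 4∤f′e ∷ All.map (λ {d} → preserved d) nz

  nowhere-zero-mod-4 : (∀ e → ShortCircuit e) →
                       Σ (Fin (m G) → ℤ) λ f → IsCirculation f × ∀ d → ¬ + 4 ∣ f d
  nowhere-zero-mod-4 circuits with nowhere-zero-on circuits (allFin (m G))
  ... | f , f-circ , nz = f , f-circ , λ d → All.lookup nz (∈-allFin d)

  four-flowing : (∀ e → ShortCircuit e) → FourFlowing G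
  four-flowing circuits with nowhere-zero-mod-4 circuits
  ... | f , f-circ , nz = byEnds , φ , nonzero ,
                          λ v → ∣⇒∣ᵤ (subst (+ 4 ∣_) (sym (∂-sumFin (λ d → + toℕ (φ d)) v)) (4∣∂φ v))
    where
    φ : Fin (m G) → Fin 4
    φ d = residue (f d)

    nonzero : ∀ d → φ d ≢ zero
    nonzero d φd≡0 = nz d (4∣residue⇒4∣ (f d) (subst (λ r → + 4 ∣ + toℕ r) (sym φd≡0) (divides 0ℤ refl)))

    4∣∂φ : ∀ v → + 4 ∣ ∂ (λ d → + toℕ (φ d)) v
    4∣∂φ v = ∣m+n∣n⇒∣m (subst (+ 4 ∣_) split (divides 0ℤ refl)) (∣m⇒∣m*n (∂ (λ d → f d /ℕ 4) v) ∣-refl)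
      where
      split : 0ℤ ≡ ∂ (λ d → + toℕ (φ d)) v + + 4 * ∂ (λ d → f d /ℕ 4) v
      split = trans (sym (f-circ v)) (trans (∂-cong (λ d → residue-quotient (f d)) v) (∂-linear _ (+ 4) _ v))


module Circuits (G : Graph) (e : Fin (m G)) where
  open Walks G e
  open Flows G

  sign : ∀ {d x y} → Joins d x y → ℤ
  sign (inj₁ _) = 1ℤ
  sign (inj₂ _) = -1ℤ

  sign-incidence : ∀ {d x y} (j : Joins d x y) v → sign j * incidence d v ≡ [ y ≟v v ] - [ x ≟v v ]
  sign-incidence         (inj₁ ends≡xy) v rewrite ends≡xy = *-identityˡ _
  sign-incidence {x = x} {y} (inj₂ ends≡yx) v rewrite ends≡yx = flip [ x ≟v v ] [ y ≟v v ]
    where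
    flip : ∀ a b → -1ℤ * (a - b) ≡ b - a
    flip = solve-∀

  pathFlow : ∀ {x z} → Walk x z → Fin (m G) → ℤ
  pathFlow here             _  = 0ℤ
  pathFlow (step d _ j w)   d′ = pathFlow w d′ + sign j * δ d d′

  ∂-pathFlow : ∀ {x z} (w : Walk x z) v → ∂ (pathFlow w) v ≡ [ z ≟v v ] - [ x ≟v v ]
  ∂-pathFlow {x} here v = trans (∂-zero v) (sym (+-inverseʳ [ x ≟v v ]))
  ∂-pathFlow {x} (step {v = y} {w = z} d d≢e j w) v = begin
    ∂ (pathFlow (step d d≢e j w)) v                     ≡⟨ ∂-linear (pathFlow w) (sign j) (δ d) v ⟩
    ∂ (pathFlow w) v + sign j * ∂ (δ d) v               ≡⟨ cong₂ (λ p q → p + sign j * q) (∂-pathFlow w v) (∂-δ d v) ⟩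
    [ z ≟v v ] - [ y ≟v v ] + sign j * incidence d v    ≡⟨ cong (_+_ ([ z ≟v v ] - [ y ≟v v ])) (sign-incidence j v) ⟩
    [ z ≟v v ] - [ y ≟v v ] + ([ y ≟v v ] - [ x ≟v v ]) ≡⟨ telescope [ x ≟v v ] [ y ≟v v ] [ z ≟v v ] ⟩
    [ z ≟v v ] - [ x ≟v v ]                             ∎
    where
    open ≡-Reasoning
    telescope : ∀ a b c → c - b + (b - a) ≡ c - a
    telescope = solve-∀

  pathFlow-e : ∀ {x z} (w : Walk x z) → pathFlow w e ≡ 0ℤ
  pathFlow-e here             = refl
  pathFlow-e (step d d≢e j w) rewrite pathFlow-e w | δ-≢ d≢e = cong (_+_ 0ℤ) (*-zeroʳ (sign j))

  -- The closed walk: e from x to z, then w backwards.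
  circuitFlow : ∀ {x z} → Walk x z → Fin (m G) → ℤ
  circuitFlow w d = δ e d + -1ℤ * pathFlow w d

  circuitFlow-isCirculation : ∀ {x z} → ends G e ≡ (x , z) → (w : Walk x z) → IsCirculation (circuitFlow w)
  circuitFlow-isCirculation {x} {z} ends-e w v = begin
    ∂ (circuitFlow w) v                 ≡⟨ ∂-linear (δ e) -1ℤ (pathFlow w) v ⟩
    ∂ (δ e) v + -1ℤ * ∂ (pathFlow w) v  ≡⟨ cong₂ (λ p q → p + -1ℤ * q) (∂-δ e v) (∂-pathFlow w v) ⟩
    incidence e v + -1ℤ * x→z           ≡⟨ cong (λ p → p + -1ℤ * x→z) incidence-e ⟩
    x→z + -1ℤ * x→z                     ≡⟨ cancel x→z ⟩
    0ℤ                                  ∎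
    where
    open ≡-Reasoning
    x→z : ℤ
    x→z = [ z ≟v v ] - [ x ≟v v ]
    incidence-e : incidence e v ≡ x→z
    incidence-e rewrite ends-e = refl
    cancel : ∀ a → a + -1ℤ * a ≡ 0ℤ
    cancel = solve-∀

  circuitFlow-e : ∀ {x z} (w : Walk x z) → circuitFlow w e ≡ 1ℤ
  circuitFlow-e w rewrite δ-refl e | pathFlow-e w = refl

  circuitFlow-≢e : ∀ {x z} (w : Walk x z) {d} → d ≢ e → circuitFlow w d ≡ - pathFlow w d
  circuitFlow-≢e w d≢e rewrite δ-≢ (≢-sym d≢e) = sym (neg-as-* (pathFlow w _))
    where
    neg-as-* : ∀ a → - a ≡ 0ℤ + -1ℤ * a
    neg-as-* = solve-∀

  -sign-small : ∀ {d x y} (j : Joins d x y) → Small (- sign j)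
  -sign-small (inj₁ _) = Any.there (Any.there (Any.here refl))
  -sign-small (inj₂ _) = Any.there (Any.here refl)

  shortCircuit-along : ∀ {x z} → ends G e ≡ (x , z) → (w : Walk x z) (d₁ d₂ : Fin (m G)) →
                  Small (circuitFlow w d₁) → Small (circuitFlow w d₂) →
                  (∀ d → d ≢ e → d ≢ d₁ → d ≢ d₂ → circuitFlow w d ≡ 0ℤ) → ShortCircuit e
  shortCircuit-along ends-e w d₁ d₂ small₁ small₂ vanishes = record
    { flow = circuitFlow w ; isCirculation = circuitFlow-isCirculation ends-e w ; flow-e = circuitFlow-e w
    ; d₁ = d₁ ; d₂ = d₂ ; small₁ = small₁ ; small₂ = small₂ ; vanishes = vanishes }

  shortCircuit : ∀ {x z} → ends G e ≡ (x , z) → ShortDetour x z → ShortCircuit e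
  shortCircuit {x} ends-e (loop refl) =
    shortCircuit-along ends-e w e e small-e small-e (λ d d≢e _ _ → circuitFlow-≢e w d≢e)
    where
    w : Walk x x
    w = here
    small-e : Small (circuitFlow w e)
    small-e = subst Small (sym (circuitFlow-e w)) (Any.there (Any.here refl))
  shortCircuit {x} {z} ends-e (parallel d d≢e j) =
    shortCircuit-along ends-e w d d small-d small-d vanishes
    where
    w : Walk x z
    w = step d d≢e j here
    at-d : circuitFlow w d ≡ - sign j
    at-d rewrite circuitFlow-≢e w d≢e | δ-refl d = value (sign j)
      where
      value : ∀ s → - (0ℤ + s * 1ℤ) ≡ - s
      value = solve-∀
    small-d : Small (circuitFlow w d)
    small-d = subst Small (sym at-d) (-sign-small j)
    vanishes : ∀ d′ → d′ ≢ e → d′ ≢ d → d′ ≢ d → circuitFlow w d′ ≡ 0ℤ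
    vanishes d′ d′≢e d′≢d _ rewrite circuitFlow-≢e w d′≢e | δ-≢ (≢-sym d′≢d) = value (sign j)
      where
      value : ∀ s → - (0ℤ + s * 0ℤ) ≡ 0ℤ
      value = solve-∀
  shortCircuit {x} {z} ends-e (triangle _ d₁ d₂ d₁≢e d₂≢e d₁≢d₂ j₁ j₂) =
    shortCircuit-along ends-e w d₁ d₂
      (subst Small (sym at-d₁) (-sign-small j₁)) (subst Small (sym at-d₂) (-sign-small j₂)) vanishes
    where
    w : Walk x z
    w = step d₁ d₁≢e j₁ (step d₂ d₂≢e j₂ here)
    at-d₁ : circuitFlow w d₁ ≡ - sign j₁
    at-d₁ rewrite circuitFlow-≢e w d₁≢e | δ-≢ (≢-sym d₁≢d₂) | δ-refl d₁ = value (sign j₂) (sign j₁)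
      where
      value : ∀ s t → - (0ℤ + s * 0ℤ + t * 1ℤ) ≡ - t
      value = solve-∀
    at-d₂ : circuitFlow w d₂ ≡ - sign j₂
    at-d₂ rewrite circuitFlow-≢e w d₂≢e | δ-≢ d₁≢d₂ | δ-refl d₂ = value (sign j₂) (sign j₁)
      where
      value : ∀ s t → - (0ℤ + s * 1ℤ + t * 0ℤ) ≡ - s
      value = solve-∀
    vanishes : ∀ d → d ≢ e → d ≢ d₁ → d ≢ d₂ → circuitFlow w d ≡ 0ℤ
    vanishes d d≢e d≢d₁ d≢d₂
      rewrite circuitFlow-≢e w d≢e | δ-≢ (≢-sym d≢d₁) | δ-≢ (≢-sym d≢d₂) =
      value (sign j₂) (sign j₁)
      where
      value : ∀ s t → - (0ℤ + s * 0ℤ + t * 0ℤ) ≡ 0ℤ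
      value = solve-∀

-- Bridgelessness only refutes the absence of a walk avoiding e; since short detours are
-- decidable, refuting their absence suffices.
short-detour : ∀ G → Chordal G → Bridgeless G → ∀ e →
               Walks.ShortDetour G e (proj₁ (ends G e)) (proj₂ (ends G e))
short-detour G chordal bridgeless e with Walks.ShortDetour? G e (proj₁ (ends G e)) (proj₂ (ends G e))
... | yes detour    = detour
... | no no-detour =
  ⊥-elim (bridgeless e λ walk → no-detour (Shortcut.walk⇒short-detour G e chordal refl walk))

corollary1p4 : (G : Graph) → Bridgeless G → Chordal G → FourFlowing G
corollary1p4 G bridgeless chordal =
  Flows.four-flowing G λ e → Circuits.shortCircuit G e refl (short-detour G chordal bridgeless e)
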